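{- Let $\{D_1,\dots,D_m\}$ be a $(v,m,k,\lambda)$-SEDF in a finite abelian group $G$ of order $v$, with $m\ge3$. If $\chi\in G_N^*$ and $\chi(D_i)\ne\chi(D_j)$ for some $1\le i,j\le m$, then $\chi(D-D_i-D_j)=\sum_{l\ne i,j}\chi(D_l)=0$ and $\chi(D_iD_j^{(-1)})=\chi(D_i)\overline{\chi(D_j)}=-\lambda$.
   Context: A $(v,m,k,\lambda)$-SEDF in a finite abelian group $G$ of order $v$ (written multiplicatively) is a collection $\{D_1,\dots,D_m\}$ of mutually disjoint $k$-subsets of $G$ such that for each $j$ and each non-identity $g\in G$, the number of pairs $(x,y)$ with $x\in D_j$, $y\in\bigcup_{i\ne j}D_i$, $xy^{ -1}=g$ equals $\lambda$ ($\lambda\ge1$); nontrivial means $k>1$. $G^*$ is the group of complex characters of $G$, $\chi_0$ the principal character; characters extend linearly to the group ring $\mathbb Z[G]$, a subset $S$ is identified with $\sum_{g\in S}g$, $D=D_1+\dots+D_m$, and $X^{(-1)}=\sum a_g g^{ -1}$ for $X=\sum a_g g$. $G_N^*=\{\chi\in G^*:\chi\ne\chi_0,\ \chi(D)\ne0\}$. -}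

module Defs where

open import Data.Nat as ℕ using (ℕ; zero; suc)
open import Data.Fin using (Fin; zero; suc; _≟_)
open import Data.Fin.Subset using (Subset; _∈_; _∩_; Empty; ∣_∣)
open import Data.Vec using (lookup)
open import Data.Bool using (Bool; true; false; _∧_; _∨_; not; if_then_else_)
open import Data.Product using (Σ; _×_; _,_)
open import Relation.Nullary using (¬_; does)
open import Relation.Binary.PropositionalEquality using (_≡_)
open import Algebra.Bundles using (CommutativeRing)
open import Level using (Level; _⊔_) renaming (suc to lsuc)

-- Finite abelian groups of order v, carried by Fin v (every finite
-- abelian group of order v is isomorphic to one of these).

record FinAbGroup (v : ℕ) : Set where
  field
    _·_     : Fin v → Fin v → Fin v
    e       : Fin v
    inv     : Fin v → Fin v
    assoc   : ∀ x y z → (x · y) · z ≡ x · (y · z)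
    comm    : ∀ x y → x · y ≡ y · x
    identityˡ : ∀ x → e · x ≡ x
    inverseˡ  : ∀ x → inv x · x ≡ e

∑ℕ : ∀ {n} → (Fin n → ℕ) → ℕ
∑ℕ {zero}  f = 0
∑ℕ {suc n} f = f zero ℕ.+ ∑ℕ (λ i → f (suc i))

#_ : ∀ {n} → (Fin n → Bool) → ℕ
# p = ∑ℕ (λ i → if p i then 1 else 0)

_≠ᵇ_ : ∀ {n} → Fin n → Fin n → Bool
i ≠ᵇ j = not (does (i ≟ j))

anyFin : ∀ {n} → (Fin n → Bool) → Bool
anyFin {zero}  p = false
anyFin {suc n} p = p zero ∨ anyFin (λ i → p (suc i))

inOthers : ∀ {v m} → (Fin m → Subset v) → Fin m → Fin v → Bool
inOthers D j y = anyFin (λ i → (i ≠ᵇ j) ∧ lookup (D i) y)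

record IsSEDF {v : ℕ} (G : FinAbGroup v) (m k lam : ℕ) (D : Fin m → Subset v) : Set where
  open FinAbGroup G
  field
    disjoint : ∀ i j → ¬ i ≡ j → Empty (D i ∩ D j)
    size     : ∀ i → ∣ D i ∣ ≡ k
    lam≥1    : 1 ℕ.≤ lam
    count    : ∀ j (g : Fin v) → ¬ g ≡ e →
               ∑ℕ (λ x → # (λ y → lookup (D j) x ∧ inOthers D j y ∧ does ((x · inv y) ≟ g)))
                 ≡ lam

-- The paper uses ℂ with complex
-- conjugation; we allow any field K with an involutive ring automorphism
-- `conj` (ℂ with complex conjugation is an instance).

record FieldWithConj (c ℓ : Level) : Set (lsuc (c ⊔ ℓ)) where
  field
    commRing : CommutativeRing c ℓ
  open CommutativeRing commRing public
    using (Carrier; _≈_; _+_; _*_; -_; _-_; 0#; 1#; setoid; refl; sym; trans)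
  field
    1≉0     : ¬ (1# ≈ 0#)
    inverse : ∀ x → ¬ (x ≈ 0#) → Σ Carrier (λ y → x * y ≈ 1#)
    conj      : Carrier → Carrier
    conj-cong : ∀ {x y} → x ≈ y → conj x ≈ conj y
    conj-+    : ∀ x y → conj (x + y) ≈ conj x + conj y
    conj-*    : ∀ x y → conj (x * y) ≈ conj x * conj y
    conj-1    : conj 1# ≈ 1#
    conj-inv  : ∀ x → conj (conj x) ≈ x

  fromℕ : ℕ → Carrier
  fromℕ zero    = 0#
  fromℕ (suc n) = 1# + fromℕ n

  ∑ : ∀ {n} → (Fin n → Carrier) → Carrier
  ∑ {zero}  f = 0#
  ∑ {suc n} f = f zero + ∑ (λ i → f (suc i))

module _ {c ℓ} (K : FieldWithConj c ℓ) {v : ℕ} (G : FinAbGroup v) where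
  open FieldWithConj K
  open FinAbGroup G

  -- A character of G: a homomorphism G → K^× whose values on inverses are
  -- the conjugates (for K = ℂ this holds automatically, values being roots
  -- of unity; together these say exactly "χ ∈ G^*").
  record IsCharacter (χ : Fin v → Carrier) : Set (c ⊔ ℓ) where
    field
      hom  : ∀ x y → χ (x · y) ≈ χ x * χ y
      unit : χ e ≈ 1#
      unitary : ∀ x → χ (inv x) ≈ conj (χ x)

  IsPrincipal : (Fin v → Carrier) → Set ℓ
  IsPrincipal χ = ∀ g → χ g ≈ 1#

  -- χ extended linearly to a subset S (identified with ∑_{g∈S} g ∈ ℤ[G])
  χˢ : (Fin v → Carrier) → Subset v → Carrier
  χˢ χ S = ∑ (λ g → if lookup S g then χ g else 0#)

  χᴰ : ∀ {m} → (Fin v → Carrier) → (Fin m → Subset v) → Carrier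
  χᴰ {m} χ D = ∑ (λ l → χˢ χ (D l))

  -- χ(D - A - B) = χ(D) - χ(A) - χ(B)
  -- χ(A B^{(-1)}) = ∑_{x ∈ A} ∑_{y ∈ B} χ(x y⁻¹)
  χ-AB⁻ : (Fin v → Carrier) → Subset v → Subset v → Carrier
  χ-AB⁻ χ A B = ∑ (λ x → ∑ (λ y →
    if lookup A x ∧ lookup B y then χ (x · inv y) else 0#))

module Submission where

-- Write Aₗ = χ(Dₗ), Bⱼ = χ(⋃_{l ≠ j} Dₗ), T = χ(D) and S = χ(G) = ∑_g χ(g).
--  (1) χ(x) S = S for every x, so S Aₗ = k S for every block; as Aᵢ ≠ Aⱼ, S = 0.
--  (2) Grouping the pairs x ∈ Dⱼ, y ∈ ⋃_{l ≠ j} Dₗ by x y⁻¹ (λ pairs for each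
--      g ≠ e, none for g = e) gives Aⱼ conj Bⱼ = λ(S - 1) = -λ, with Aⱼ + Bⱼ = T.
--  (3) Field algebra: if a + a' = T and a conj a' = -λ, then p = a conj T is real
--      and p² = (p + λ) T conj T; two distinct roots of this quadratic add up to
--      T conj T, hence Aᵢ + Aⱼ = T as T ≠ 0.  The four conclusions follow.

open import Defs
open import Algebra using (CommutativeRing; AbelianGroup)
open import Data.Bool using (Bool; true; false; not; if_then_else_; _∧_)
open import Data.Empty using (⊥; ⊥-elim)
open import Data.Fin using (Fin; zero; suc; _≟_)
open import Data.Fin.Permutation using (Permutation; permutation; _⟨$⟩ʳ_)
open import Data.Fin.Properties using (punchInᵢ≢i; suc-injective)
open import Data.Fin.Subset using (Subset; ∣_∣)
open import Data.Fin.Subset.Properties using (x∈p∩q⁺)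
open import Data.Nat as ℕ using (ℕ; zero; suc; _≤_)
open import Data.Product using (_×_; _,_; Σ)
open import Data.Vec using ([]; _∷_; lookup)
open import Data.Vec.Functional using (removeAt)
open import Data.Vec.Properties using (lookup⇒[]=)
open import Function using (_∘_)
open import Level using (0ℓ)
open import Relation.Nullary using (¬_)
open import Relation.Nullary.Decidable using (does; yes; no; dec-true; dec-false)
import Relation.Binary.PropositionalEquality as ≡
open ≡ using (_≡_)

≠ᵇ-irrefl : ∀ {n} (i : Fin n) → (i ≠ᵇ i) ≡ false
≠ᵇ-irrefl i = ≡.cong not (dec-true (i ≟ i) ≡.refl)

≢⇒≠ᵇ : ∀ {n} {i j : Fin n} → ¬ i ≡ j → (i ≠ᵇ j) ≡ true
≢⇒≠ᵇ {i = i} {j} i≢j = ≡.cong not (dec-false (i ≟ j) i≢j)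

≠ᵇ⇒≢ : ∀ {n} {i j : Fin n} → (i ≠ᵇ j) ≡ true → ¬ i ≡ j
≠ᵇ⇒≢ {i = i} i≠i ≡.refl with ≡.trans (≡.sym i≠i) (≠ᵇ-irrefl i)
... | ()

anyFin-witness : ∀ {n} (Q : Fin n → Bool) → anyFin Q ≡ true → Σ (Fin n) (λ l → Q l ≡ true)
anyFin-witness {suc n} Q ∃Q with Q zero in Q0
... | true  = zero , Q0
... | false with anyFin-witness (λ l → Q (suc l)) ∃Q
...   | l , Ql = suc l , Ql

module FieldFacts {c ℓ} (K : FieldWithConj c ℓ) where
  open FieldWithConj K
  open CommutativeRing commRing
    using ( +-cong; +-congˡ; +-congʳ; +-assoc; +-identityˡ; +-identityʳ
          ; *-congˡ; *-congʳ; *-assoc; *-comm; *-identityˡ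
          ; zeroˡ; zeroʳ; distribˡ; distribʳ; -‿cong; -‿inverseˡ; -‿inverseʳ
          ; semiring; commutativeSemiring; ring; +-group)
  open import Algebra.Properties.Semiring.Sum semiring
    using ( sum; sum-cong-≋; sum-cong-≗; sum-replicate-zero; sum-remove; sum-permute
          ; ∑-distrib-+; *-distribˡ-sum; *-distribʳ-sum)
    renaming (∑-comm to sum-comm)
  open import Algebra.Properties.Group +-group
    using (x∙y⁻¹≈ε⇒x≈y; inverseˡ-unique; //-rightDividesˡ; identityʳ-unique)
  open import Algebra.Properties.Ring ring using (x+x≈x⇒x≈0)
  open import Algebra.Solver.Ring.NaturalCoefficients.Default commutativeSemiring
    using (solve; _:+_; _:*_; _:=_)
  open import Relation.Binary.Reasoning.Setoid setoid

  ∑≡sum : ∀ {n} (f : Fin n → Carrier) → ∑ f ≡ sum f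
  ∑≡sum {zero}  f = ≡.refl
  ∑≡sum {suc n} f = ≡.cong (f zero +_) (∑≡sum (λ i → f (suc i)))

  ∑-cong : ∀ {n} {f g : Fin n → Carrier} → (∀ i → f i ≈ g i) → ∑ f ≈ ∑ g
  ∑-cong {f = f} {g} f≈g = begin
    ∑ f   ≡⟨ ∑≡sum f ⟩
    sum f ≈⟨ sum-cong-≋ f≈g ⟩
    sum g ≡⟨ ∑≡sum g ⟨
    ∑ g   ∎

  ∑-zero : ∀ {n} {f : Fin n → Carrier} → (∀ i → f i ≈ 0#) → ∑ f ≈ 0#
  ∑-zero {n} {f} f≈0 = begin
    ∑ f                ≈⟨ ∑-cong f≈0 ⟩
    ∑ {n} (λ _ → 0#)   ≡⟨ ∑≡sum {n} (λ _ → 0#) ⟩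
    sum {n} (λ _ → 0#) ≈⟨ sum-replicate-zero n ⟩
    0#                 ∎

  ∑-+ : ∀ {n} (f g : Fin n → Carrier) → ∑ (λ i → f i + g i) ≈ ∑ f + ∑ g
  ∑-+ f g = begin
    ∑ (λ i → f i + g i)   ≡⟨ ∑≡sum (λ i → f i + g i) ⟩
    sum (λ i → f i + g i) ≈⟨ ∑-distrib-+ f g ⟩
    sum f + sum g         ≡⟨ ≡.cong₂ _+_ (∑≡sum f) (∑≡sum g) ⟨
    ∑ f + ∑ g             ∎

  ∑-comm : ∀ {m n} (f : Fin m → Fin n → Carrier) →
           ∑ (λ i → ∑ (λ j → f i j)) ≈ ∑ (λ j → ∑ (λ i → f i j))
  ∑-comm f = begin
    ∑ (λ i → ∑ (λ j → f i j))     ≡⟨ ∑∑≡sumsum f ⟩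
    sum (λ i → sum (λ j → f i j)) ≈⟨ sum-comm f ⟩
    sum (λ j → sum (λ i → f i j)) ≡⟨ ∑∑≡sumsum (λ j i → f i j) ⟨
    ∑ (λ j → ∑ (λ i → f i j))     ∎
    where
    ∑∑≡sumsum : ∀ {m n} (h : Fin m → Fin n → Carrier) →
                ∑ (λ i → ∑ (h i)) ≡ sum (λ i → sum (h i))
    ∑∑≡sumsum h = ≡.trans (∑≡sum (λ i → ∑ (h i))) (sum-cong-≗ (λ i → ∑≡sum (h i)))

  ∑-*ˡ : ∀ {n} (a : Carrier) (f : Fin n → Carrier) → a * ∑ f ≈ ∑ (λ i → a * f i)
  ∑-*ˡ a f = begin
    a * ∑ f               ≡⟨ ≡.cong (a *_) (∑≡sum f) ⟩
    a * sum f             ≈⟨ *-distribˡ-sum a f ⟩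
    sum (λ i → a * f i)   ≡⟨ ∑≡sum (λ i → a * f i) ⟨
    ∑ (λ i → a * f i)     ∎

  ∑-*ʳ : ∀ {n} (a : Carrier) (f : Fin n → Carrier) → ∑ f * a ≈ ∑ (λ i → f i * a)
  ∑-*ʳ a f = begin
    ∑ f * a               ≡⟨ ≡.cong (_* a) (∑≡sum f) ⟩
    sum f * a             ≈⟨ *-distribʳ-sum a f ⟩
    sum (λ i → f i * a)   ≡⟨ ∑≡sum (λ i → f i * a) ⟨
    ∑ (λ i → f i * a)     ∎

  ∑-single : ∀ {n} (f : Fin n → Carrier) (h : Fin n) →
             (∀ i → ¬ i ≡ h → f i ≈ 0#) → ∑ f ≈ f h
  ∑-single {suc n} f h f≈0 = begin
    ∑ f                         ≡⟨ ∑≡sum f ⟩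
    sum f                       ≈⟨ sum-remove {i = h} f ⟩
    f h + sum (removeAt f h)    ≈⟨ +-congˡ (trans (sum-cong-≋ (λ j → f≈0 _ (punchInᵢ≢i h j)))
                                                  (sum-replicate-zero n)) ⟩
    f h + 0#                    ≈⟨ +-identityʳ (f h) ⟩
    f h                         ∎

  ∑-split : ∀ {n} (f : Fin n → Carrier) (i : Fin n) →
            ∑ f ≈ f i + ∑ (λ l → if l ≠ᵇ i then f l else 0#)
  ∑-split {n} f i = begin
    ∑ f                                        ≈⟨ ∑-cong (λ l → split (l ≠ᵇ i) (f l)) ⟩
    ∑ (λ l → at-i l + others l)                ≈⟨ ∑-+ at-i others ⟩
    ∑ at-i + ∑ others                          ≈⟨ +-congʳ (∑-single at-i i at-i-vanishes) ⟩
    at-i i + ∑ others                          ≈⟨ +-congʳ at-i-at-i ⟩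
    f i + ∑ others                             ∎
    where
    at-i others : Fin n → Carrier
    at-i   l = if l ≠ᵇ i then 0# else f l
    others l = if l ≠ᵇ i then f l else 0#
    split : ∀ b x → x ≈ (if b then 0# else x) + (if b then x else 0#)
    split true  x = sym (+-identityˡ x)
    split false x = sym (+-identityʳ x)
    at-i-vanishes : ∀ l → ¬ l ≡ i → at-i l ≈ 0#
    at-i-vanishes l l≢i rewrite ≢⇒≠ᵇ l≢i = refl
    at-i-at-i : at-i i ≈ f i
    at-i-at-i rewrite ≠ᵇ-irrefl i = refl

  ∑-permute : ∀ {n} (f : Fin n → Carrier) (π : Permutation n n) → ∑ f ≈ ∑ (λ i → f (π ⟨$⟩ʳ i))
  ∑-permute f π = begin
    ∑ f                     ≡⟨ ∑≡sum f ⟩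
    sum f                   ≈⟨ sum-permute f π ⟩
    sum (λ i → f (π ⟨$⟩ʳ i)) ≡⟨ ∑≡sum (λ i → f (π ⟨$⟩ʳ i)) ⟨
    ∑ (λ i → f (π ⟨$⟩ʳ i))   ∎

  ∑-indicator : ∀ {n} (f : Fin n → Carrier) (h : Fin n) →
                ∑ (λ g → if does (h ≟ g) then f g else 0#) ≈ f h
  ∑-indicator f h = trans (∑-single _ h off-h) at-h
    where
    off-h : ∀ g → ¬ g ≡ h → (if does (h ≟ g) then f g else 0#) ≈ 0#
    off-h g g≢h rewrite dec-false (h ≟ g) (g≢h ∘ ≡.sym) = refl
    at-h : (if does (h ≟ h) then f h else 0#) ≈ f h
    at-h rewrite dec-true (h ≟ h) ≡.refl = refl

  ∑-split-two : ∀ {n} (f : Fin n → Carrier) (i j : Fin n) → ¬ j ≡ i →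
                ∑ f ≈ f i + (f j + ∑ (λ l → if (l ≠ᵇ i) ∧ (l ≠ᵇ j) then f l else 0#))
  ∑-split-two {n} f i j j≢i = begin
    ∑ f                                                      ≈⟨ ∑-split f i ⟩
    f i + ∑ f≠i                                              ≈⟨ +-congˡ (∑-split f≠i j) ⟩
    f i + (f≠i j + ∑ (λ l → if l ≠ᵇ j then f≠i l else 0#))   ≈⟨ +-congˡ (+-cong f≠i-at-j (∑-cong nested)) ⟩
    f i + (f j + ∑ (λ l → if (l ≠ᵇ i) ∧ (l ≠ᵇ j) then f l else 0#)) ∎
    where
    f≠i : Fin n → Carrier
    f≠i l = if l ≠ᵇ i then f l else 0#
    f≠i-at-j : f≠i j ≈ f j
    f≠i-at-j rewrite ≢⇒≠ᵇ j≢i = refl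
    nested : ∀ l → (if l ≠ᵇ j then f≠i l else 0#) ≈ (if (l ≠ᵇ i) ∧ (l ≠ᵇ j) then f l else 0#)
    nested l with l ≠ᵇ i | l ≠ᵇ j
    ... | true  | _     = refl
    ... | false | true  = refl
    ... | false | false = refl

  ∑-others-vanish : ∀ {n} (f : Fin n → Carrier) (i j : Fin n) → ¬ j ≡ i → f i + f j ≈ ∑ f →
                    ∑ (λ l → if (l ≠ᵇ i) ∧ (l ≠ᵇ j) then f l else 0#) ≈ 0#
  ∑-others-vanish f i j j≢i fi+fj≈∑f = identityʳ-unique (∑ f) others (begin
    ∑ f + others         ≈⟨ +-congʳ fi+fj≈∑f ⟨
    (f i + f j) + others ≈⟨ +-assoc (f i) (f j) others ⟩
    f i + (f j + others) ≈⟨ ∑-split-two f i j j≢i ⟨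
    ∑ f                  ∎)
    where
    others : Carrier
    others = ∑ (λ l → if (l ≠ᵇ i) ∧ (l ≠ᵇ j) then f l else 0#)

  ∑-anyFin : ∀ {n} (Q : Fin n → Bool) → (∀ l l' → Q l ≡ true → Q l' ≡ true → l ≡ l') →
             ∀ x → ∑ (λ l → if Q l then x else 0#) ≈ (if anyFin Q then x else 0#)
  ∑-anyFin {zero}  Q Q-unique x = refl
  ∑-anyFin {suc n} Q Q-unique x with Q zero in Q0
  ... | true  = trans (+-congˡ (∑-zero rest-vanishes)) (+-identityʳ x)
    where
    rest-vanishes : ∀ l → (if Q (suc l) then x else 0#) ≈ 0#
    rest-vanishes l with Q (suc l) in Ql
    ... | true with () ← Q-unique zero (suc l) Q0 Ql
    ... | false = refl
  ... | false = trans (+-identityˡ _)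
    (∑-anyFin (λ l → Q (suc l)) (λ l l' Ql Ql' → suc-injective (Q-unique (suc l) (suc l') Ql Ql')) x)

  fromℕ-+ : ∀ m n → fromℕ (m ℕ.+ n) ≈ fromℕ m + fromℕ n
  fromℕ-+ zero    n = sym (+-identityˡ (fromℕ n))
  fromℕ-+ (suc m) n = trans (+-congˡ (fromℕ-+ m n)) (sym (+-assoc 1# (fromℕ m) (fromℕ n)))

  fromℕ-∑ℕ : ∀ {n} (f : Fin n → ℕ) → fromℕ (∑ℕ f) ≈ ∑ (λ i → fromℕ (f i))
  fromℕ-∑ℕ {zero}  f = refl
  fromℕ-∑ℕ {suc n} f = trans (fromℕ-+ (f zero) _) (+-congˡ (fromℕ-∑ℕ (λ i → f (suc i))))

  fromℕ-# : ∀ {n} (p : Fin n → Bool) → fromℕ (# p) ≈ ∑ (λ i → if p i then 1# else 0#)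
  fromℕ-# p = trans (fromℕ-∑ℕ (λ i → if p i then 1 else 0)) (∑-cong (λ i → fromℕ-indicator (p i)))
    where
    fromℕ-indicator : ∀ b → fromℕ (if b then 1 else 0) ≈ (if b then 1# else 0#)
    fromℕ-indicator true  = +-identityʳ 1#
    fromℕ-indicator false = refl

  ∑-subset-const : ∀ {n} (p : Subset n) (c : Carrier) →
                   ∑ (λ g → if lookup p g then c else 0#) ≈ fromℕ ∣ p ∣ * c
  ∑-subset-const []          c = sym (zeroˡ c)
  ∑-subset-const (true ∷ p)  c =
    trans (+-cong (sym (*-identityˡ c)) (∑-subset-const p c)) (sym (distribʳ c 1# (fromℕ ∣ p ∣)))
  ∑-subset-const (false ∷ p) c = trans (+-identityˡ _) (∑-subset-const p c)

  cancelˡ : ∀ {a x y} → ¬ a ≈ 0# → a * x ≈ a * y → x ≈ y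
  cancelˡ {a} {x} {y} a≉0 ax≈ay with inverse a a≉0
  ... | a⁻¹ , aa⁻¹≈1 = begin
    x             ≈⟨ *-identityˡ x ⟨
    1# * x        ≈⟨ *-congʳ a⁻¹a≈1 ⟨
    (a⁻¹ * a) * x ≈⟨ *-assoc a⁻¹ a x ⟩
    a⁻¹ * (a * x) ≈⟨ *-congˡ ax≈ay ⟩
    a⁻¹ * (a * y) ≈⟨ *-assoc a⁻¹ a y ⟨
    (a⁻¹ * a) * y ≈⟨ *-congʳ a⁻¹a≈1 ⟩
    1# * y        ≈⟨ *-identityˡ y ⟩
    y             ∎
    where
    a⁻¹a≈1 : a⁻¹ * a ≈ 1#
    a⁻¹a≈1 = trans (*-comm a⁻¹ a) aa⁻¹≈1

  -- (a - b)(x - y) = 0 with a ≠ b forces x = y; stated without subtraction.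
  cross-cancel : ∀ {a b x y} → ¬ a ≈ b → a * x + b * y ≈ a * y + b * x → x ≈ y
  cross-cancel {a} {b} {x} {y} a≉b eq = cancelˡ a-b≉0 (begin
    (a - b) * x                       ≈⟨ +-identityʳ _ ⟨
    (a - b) * x + 0#                  ≈⟨ +-congˡ (b-b-annihilates y) ⟨
    (a - b) * x + (b - b) * y         ≈⟨ solve 5 (λ a b nb x y → (a :+ nb) :* x :+ (b :+ nb) :* y
                                                      := (a :* x :+ b :* y) :+ nb :* (x :+ y)) refl a b (- b) x y ⟩
    (a * x + b * y) + (- b) * (x + y) ≈⟨ +-congʳ eq ⟩
    (a * y + b * x) + (- b) * (x + y) ≈⟨ solve 5 (λ a b nb x y → (a :* y :+ b :* x) :+ nb :* (x :+ y)
                                                      := (a :+ nb) :* y :+ (b :+ nb) :* x) refl a b (- b) x y ⟩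
    (a - b) * y + (b - b) * x         ≈⟨ +-congˡ (b-b-annihilates x) ⟩
    (a - b) * y + 0#                  ≈⟨ +-identityʳ _ ⟩
    (a - b) * y                       ∎)
    where
    a-b≉0 : ¬ a - b ≈ 0#
    a-b≉0 = a≉b ∘ x∙y⁻¹≈ε⇒x≈y a b
    b-b-annihilates : ∀ z → (b - b) * z ≈ 0#
    b-b-annihilates z = trans (*-congʳ (-‿inverseʳ b)) (zeroˡ z)

  cancel-common : ∀ {a b x} → ¬ a ≈ b → a * x ≈ b * x → x ≈ 0#
  cancel-common {a} {b} {x} a≉b ax≈bx = cross-cancel a≉b (begin
    a * x + b * 0# ≈⟨ +-congˡ (zeroʳ b) ⟩
    a * x + 0#     ≈⟨ +-identityʳ (a * x) ⟩
    a * x          ≈⟨ ax≈bx ⟩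
    b * x          ≈⟨ +-identityˡ (b * x) ⟨
    0# + b * x     ≈⟨ +-congʳ (zeroʳ a) ⟨
    a * 0# + b * x ∎)

  conj-0 : conj 0# ≈ 0#
  conj-0 = x+x≈x⇒x≈0 (conj 0#) (trans (sym (conj-+ 0# 0#)) (conj-cong (+-identityʳ 0#)))

  conj-neg : ∀ x → conj (- x) ≈ - conj x
  conj-neg x = inverseˡ-unique (conj (- x)) (conj x)
    (trans (sym (conj-+ (- x) x)) (trans (conj-cong (-‿inverseˡ x)) conj-0))

  conj-fromℕ : ∀ n → conj (fromℕ n) ≈ fromℕ n
  conj-fromℕ zero    = conj-0
  conj-fromℕ (suc n) = trans (conj-+ 1# (fromℕ n)) (+-cong conj-1 (conj-fromℕ n))

  conj-∑ : ∀ {n} (f : Fin n → Carrier) → conj (∑ f) ≈ ∑ (λ i → conj (f i))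
  conj-∑ {zero}  f = conj-0
  conj-∑ {suc n} f = trans (conj-+ _ _) (+-congˡ (conj-∑ (λ i → f (suc i))))

  conj-if : ∀ b x → conj (if b then x else 0#) ≈ (if b then conj x else 0#)
  conj-if true  x = refl
  conj-if false x = conj-0

  conj-nonzero : ∀ {x} → ¬ x ≈ 0# → ¬ conj x ≈ 0#
  conj-nonzero {x} x≉0 cx≈0 = x≉0 (trans (sym (conj-inv x)) (trans (conj-cong cx≈0) conj-0))

  -- Suppose a + a' = T and a · conj a' = -L with L real.  Then p = a · conj T
  -- is real and is a root of x² = (x + L) · N, where N = T · conj T.
  norm-equation : ∀ {a a' T L} → conj L ≈ L → a + a' ≈ T → a * conj a' ≈ - L →
                  (a * conj T) * (a * conj T) ≈ (a * conj T + L) * (T * conj T)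
  norm-equation {a} {a'} {T} {L} L-real a+a'≈T aa'≈-L = begin
    p * p                       ≈⟨ *-congˡ p-real ⟨
    p * conj p                  ≈⟨ *-congˡ (trans (conj-* a (conj T)) (*-congˡ (conj-inv T))) ⟩
    (a * conj T) * (conj a * T) ≈⟨ solve 4 (λ a cT ca T → (a :* cT) :* (ca :* T) := (a :* ca) :* (T :* cT))
                                         refl a (conj T) (conj a) T ⟩
    n * (T * conj T)            ≈⟨ *-congʳ n≈p+L ⟩
    (p + L) * (T * conj T)      ∎
    where
    p n : Carrier
    p = a * conj T
    n = a * conj a
    p≈n-L : p ≈ n - L
    p≈n-L = begin
      a * conj T             ≈⟨ *-congˡ (conj-cong a+a'≈T) ⟨
      a * conj (a + a')      ≈⟨ *-congˡ (conj-+ a a') ⟩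
      a * (conj a + conj a') ≈⟨ distribˡ a (conj a) (conj a') ⟩
      n + a * conj a'        ≈⟨ +-congˡ aa'≈-L ⟩
      n - L                  ∎
    n≈p+L : n ≈ p + L
    n≈p+L = trans (sym (//-rightDividesˡ L n)) (+-congʳ (sym p≈n-L))
    n-real : conj n ≈ n
    n-real = trans (conj-* a (conj a)) (trans (*-congˡ (conj-inv a)) (*-comm (conj a) a))
    p-real : conj p ≈ p
    p-real = begin
      conj p              ≈⟨ conj-cong p≈n-L ⟩
      conj (n - L)        ≈⟨ conj-+ n (- L) ⟩
      conj n + conj (- L) ≈⟨ +-cong n-real (trans (conj-neg L) (-‿cong L-real)) ⟩
      n - L               ≈⟨ p≈n-L ⟨
      p                   ∎

  two-roots : ∀ {p q L N} → ¬ p ≈ q → p * p ≈ (p + L) * N → q * q ≈ (q + L) * N → p + q ≈ N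
  two-roots {p} {q} {L} {N} p≉q p-root q-root = cross-cancel p≉q (begin
    p * (p + q) + q * N           ≈⟨ solve 3 (λ p q N → p :* (p :+ q) :+ q :* N := (p :* p :+ q :* N) :+ p :* q)
                                           refl p q N ⟩
    (p * p + q * N) + p * q       ≈⟨ +-congʳ (+-congʳ p-root) ⟩
    ((p + L) * N + q * N) + p * q ≈⟨ +-congʳ (solve 4 (λ p q L N → (p :+ L) :* N :+ q :* N := (q :+ L) :* N :+ p :* N)
                                                     refl p q L N) ⟩
    ((q + L) * N + p * N) + p * q ≈⟨ +-congʳ (+-congʳ q-root) ⟨
    (q * q + p * N) + p * q       ≈⟨ solve 3 (λ p q N → (q :* q :+ p :* N) :+ p :* q := p :* N :+ q :* (p :+ q))
                                           refl p q N ⟩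
    p * N + q * (p + q)           ∎)

  complementary-pair : ∀ {a a' b b' T L} → conj L ≈ L → ¬ T ≈ 0# → ¬ a ≈ b →
                       a + a' ≈ T → a * conj a' ≈ - L →
                       b + b' ≈ T → b * conj b' ≈ - L → a + b ≈ T
  complementary-pair {a} {a'} {b} {b'} {T} {L} L-real T≉0 a≉b a+a'≈T aa'≈-L b+b'≈T bb'≈-L =
    cancelˡ cT≉0 (begin
      conj T * (a + b)        ≈⟨ distribˡ (conj T) a b ⟩
      conj T * a + conj T * b ≈⟨ +-cong (*-comm (conj T) a) (*-comm (conj T) b) ⟩
      a * conj T + b * conj T ≈⟨ two-roots p≉q (norm-equation L-real a+a'≈T aa'≈-L)
                                               (norm-equation L-real b+b'≈T bb'≈-L) ⟩
      T * conj T              ≈⟨ *-comm T (conj T) ⟩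
      conj T * T              ∎)
    where
    cT≉0 : ¬ conj T ≈ 0#
    cT≉0 = conj-nonzero T≉0
    p≉q : ¬ a * conj T ≈ b * conj T
    p≉q p≈q = a≉b (cancelˡ cT≉0 (trans (*-comm (conj T) a) (trans p≈q (*-comm b (conj T)))))

module GroupFacts {v : ℕ} (G : FinAbGroup v) where
  open FinAbGroup G

  abelianGroup : AbelianGroup 0ℓ 0ℓ
  abelianGroup = record
    { Carrier = Fin v ; _≈_ = _≡_ ; _∙_ = _·_ ; ε = e ; _⁻¹ = inv
    ; isAbelianGroup = record
      { isGroup = record
        { isMonoid = record
          { isSemigroup = record
            { isMagma = record { isEquivalence = ≡.isEquivalence ; ∙-cong = ≡.cong₂ _·_ }
            ; assoc   = assoc }
          ; identity = identityˡ , λ x → ≡.trans (comm x e) (identityˡ x) }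
        ; inverse = inverseˡ , λ x → ≡.trans (comm x (inv x)) (inverseˡ x)
        ; ⁻¹-cong = ≡.cong inv }
      ; comm = comm } }

  open import Algebra.Properties.Group (AbelianGroup.group abelianGroup)
    using (x∙y⁻¹≈ε⇒x≈y; \\-leftDividesˡ; \\-leftDividesʳ)

  translation : Fin v → Permutation v v
  translation x = permutation (x ·_) (inv x ·_) (\\-leftDividesˡ x) (\\-leftDividesʳ x)

  diffCount : (P Q : Fin v → Bool) → Fin v → ℕ
  diffCount P Q g = ∑ℕ (λ x → # (λ y → P x ∧ Q y ∧ does ((x · inv y) ≟ g)))

  diffCount-e : (P Q : Fin v → Bool) → (∀ y → P y ≡ true → Q y ≡ true → ⊥) → diffCount P Q e ≡ 0
  diffCount-e P Q disjoint = ∑ℕ-zero (λ x → ∑ℕ-zero (λ y → no-representation x y))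
    where
    ∑ℕ-zero : ∀ {n} {f : Fin n → ℕ} → (∀ i → f i ≡ 0) → ∑ℕ f ≡ 0
    ∑ℕ-zero {zero}  f≡0 = ≡.refl
    ∑ℕ-zero {suc n} f≡0 = ≡.cong₂ ℕ._+_ (f≡0 zero) (∑ℕ-zero (λ i → f≡0 (suc i)))
    no-representation : ∀ x y → (if P x ∧ Q y ∧ does ((x · inv y) ≟ e) then 1 else 0) ≡ 0
    no-representation x y with P x in Px | Q y in Qy | (x · inv y) ≟ e
    ... | true  | true  | yes xy⁻¹≡e with ≡.refl ← x∙y⁻¹≈ε⇒x≈y x y xy⁻¹≡e = ⊥-elim (disjoint x Px Qy)
    ... | true  | true  | no _ = ≡.refl
    ... | true  | false | _    = ≡.refl
    ... | false | _     | _    = ≡.refl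

module Characters {c ℓ} (K : FieldWithConj c ℓ) {v : ℕ} (G : FinAbGroup v)
                  (χ : Fin v → FieldWithConj.Carrier K) (isχ : IsCharacter K G χ) where
  open FieldWithConj K
  open FieldFacts K
  open GroupFacts G
  open FinAbGroup G using (_·_; e; inv)
  open IsCharacter isχ
  open CommutativeRing commRing
    using (+-cong; +-identityˡ; *-congˡ; *-congʳ; *-identityˡ; *-identityʳ; zeroˡ; zeroʳ; +-group)
  open import Algebra.Properties.Group +-group using (inverseʳ-unique)
  open import Relation.Binary.Reasoning.Setoid setoid

  χ[_] : (Fin v → Bool) → Carrier
  χ[ P ] = ∑ (λ g → if P g then χ g else 0#)

  χ[_/_] : (Fin v → Bool) → (Fin v → Bool) → Carrier
  χ[ P / Q ] = ∑ (λ x → ∑ (λ y → if P x ∧ Q y then χ (x · inv y) else 0#))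

  S : Carrier
  S = ∑ χ

  -- χ(x) χ(G) = χ(xG) = χ(G).
  χ-absorbs : ∀ x → χ x * S ≈ S
  χ-absorbs x = begin
    χ x * ∑ χ               ≈⟨ ∑-*ˡ (χ x) χ ⟩
    ∑ (λ g → χ x * χ g)     ≈⟨ ∑-cong (λ g → hom x g) ⟨
    ∑ (λ g → χ (x · g))     ≈⟨ ∑-permute χ (translation x) ⟨
    ∑ χ                     ∎

  χ-subset-absorbs : (A : Subset v) → χ[ lookup A ] * S ≈ fromℕ ∣ A ∣ * S
  χ-subset-absorbs A = begin
    χ[ lookup A ] * S                               ≈⟨ ∑-*ʳ S (λ g → if lookup A g then χ g else 0#) ⟩
    ∑ (λ g → (if lookup A g then χ g else 0#) * S)  ≈⟨ ∑-cong (λ g → absorb (lookup A g) g) ⟩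
    ∑ (λ g → if lookup A g then S else 0#)          ≈⟨ ∑-subset-const A S ⟩
    fromℕ ∣ A ∣ * S                                 ∎
    where
    absorb : ∀ b g → (if b then χ g else 0#) * S ≈ (if b then S else 0#)
    absorb true  g = χ-absorbs g
    absorb false g = zeroˡ S

  χ-sum-vanishes : (A B : Subset v) → ∣ A ∣ ≡ ∣ B ∣ → ¬ χ[ lookup A ] ≈ χ[ lookup B ] → S ≈ 0#
  χ-sum-vanishes A B |A|≡|B| χA≉χB = cancel-common χA≉χB (begin
    χ[ lookup A ] * S ≈⟨ χ-subset-absorbs A ⟩
    fromℕ ∣ A ∣ * S   ≡⟨ ≡.cong (λ n → fromℕ n * S) |A|≡|B| ⟩
    fromℕ ∣ B ∣ * S   ≈⟨ χ-subset-absorbs B ⟨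
    χ[ lookup B ] * S ∎)

  -- χ(P Q⁽⁻¹⁾) = χ(P) · conj χ(Q), since χ(y⁻¹) = conj χ(y).
  χ-product : ∀ P Q → χ[ P / Q ] ≈ χ[ P ] * conj χ[ Q ]
  χ-product P Q = begin
    χ[ P / Q ]                    ≈⟨ ∑-cong (λ x → ∑-cong (λ y → factor x y)) ⟩
    ∑ (λ x → ∑ (λ y → u x * w y)) ≈⟨ ∑-cong (λ x → ∑-*ˡ (u x) w) ⟨
    ∑ (λ x → u x * ∑ w)           ≈⟨ ∑-*ʳ (∑ w) u ⟨
    ∑ u * ∑ w                     ≈⟨ *-congˡ conj-χ[Q] ⟨
    χ[ P ] * conj χ[ Q ]          ∎
    where
    u w : Fin v → Carrier
    u x = if P x then χ x else 0#
    w y = if Q y then conj (χ y) else 0#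
    factor : ∀ x y → (if P x ∧ Q y then χ (x · inv y) else 0#) ≈ u x * w y
    factor x y with P x | Q y
    ... | true  | true  = trans (hom x (inv y)) (*-congˡ (unitary y))
    ... | true  | false = sym (zeroʳ _)
    ... | false | _     = sym (zeroˡ _)
    conj-χ[Q] : conj χ[ Q ] ≈ ∑ w
    conj-χ[Q] = trans (conj-∑ (λ y → if Q y then χ y else 0#)) (∑-cong (λ y → conj-if (Q y) (χ y)))

  -- Grouping the pairs (x, y) by the value of x y⁻¹:
  -- χ(P Q⁽⁻¹⁾) = ∑_g χ(g) · #{(x, y) : P x, Q y, x y⁻¹ = g}.
  χ-difference : ∀ P Q → χ[ P / Q ] ≈ ∑ (λ g → χ g * fromℕ (diffCount P Q g))
  χ-difference P Q = begin
    χ[ P / Q ]                                 ≈⟨ ∑-cong (λ x → ∑-cong (λ y → expand (P x) (Q y) (x · inv y))) ⟩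
    ∑ (λ x → ∑ (λ y → ∑ (λ g → term x y g)))   ≈⟨ ∑-cong (λ x → ∑-comm (term x)) ⟩
    ∑ (λ x → ∑ (λ g → ∑ (λ y → term x y g)))   ≈⟨ ∑-comm (λ x g → ∑ (λ y → term x y g)) ⟩
    ∑ (λ g → ∑ (λ x → ∑ (λ y → term x y g)))   ≈⟨ ∑-cong factor-out ⟩
    ∑ (λ g → χ g * fromℕ (diffCount P Q g))    ∎
    where
    R : Fin v → Fin v → Fin v → Bool
    R x y g = P x ∧ Q y ∧ does ((x · inv y) ≟ g)
    term indicator : Fin v → Fin v → Fin v → Carrier
    term      x y g = if R x y g then χ g else 0#
    indicator x y g = if R x y g then 1# else 0#
    expand : ∀ a b h → (if a ∧ b then χ h else 0#) ≈ ∑ (λ g → if a ∧ b ∧ does (h ≟ g) then χ g else 0#)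
    expand true  true  h = sym (∑-indicator χ h)
    expand true  false h = sym (∑-zero {v} (λ _ → refl))
    expand false _     h = sym (∑-zero {v} (λ _ → refl))
    scale : ∀ b g → (if b then χ g else 0#) ≈ χ g * (if b then 1# else 0#)
    scale true  g = sym (*-identityʳ (χ g))
    scale false g = sym (zeroʳ (χ g))
    count≈ : ∀ g → fromℕ (diffCount P Q g) ≈ ∑ (λ x → ∑ (λ y → indicator x y g))
    count≈ g = trans (fromℕ-∑ℕ (λ x → # (λ y → R x y g))) (∑-cong (λ x → fromℕ-# (λ y → R x y g)))
    factor-out : ∀ g → ∑ (λ x → ∑ (λ y → term x y g)) ≈ χ g * fromℕ (diffCount P Q g)
    factor-out g = begin
      ∑ (λ x → ∑ (λ y → term x y g))              ≈⟨ ∑-cong (λ x → ∑-cong (λ y → scale (R x y g) g)) ⟩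
      ∑ (λ x → ∑ (λ y → χ g * indicator x y g))   ≈⟨ ∑-cong (λ x → ∑-*ˡ (χ g) (λ y → indicator x y g)) ⟨
      ∑ (λ x → χ g * ∑ (λ y → indicator x y g))   ≈⟨ ∑-*ˡ (χ g) (λ x → ∑ (λ y → indicator x y g)) ⟨
      χ g * ∑ (λ x → ∑ (λ y → indicator x y g))   ≈⟨ *-congˡ (count≈ g) ⟨
      χ g * fromℕ (diffCount P Q g)               ∎

  ∑-χ-off-identity : S ≈ 0# → ∀ {L} (c : Fin v → Carrier) → c e ≈ 0# → (∀ g → ¬ g ≡ e → c g ≈ L) →
                     ∑ (λ g → χ g * c g) ≈ - L
  ∑-χ-off-identity S≈0 {L} c ce≈0 c≈L = inverseʳ-unique L (∑ (λ g → χ g * c g)) (begin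
    L + ∑ (λ g → χ g * c g) ≈⟨ +-cong (sym χe*L≈L) weighted≈rest ⟩
    χ e * L + ∑ rest        ≈⟨ ∑-split (λ g → χ g * L) e ⟨
    ∑ (λ g → χ g * L)       ≈⟨ ∑-*ʳ L χ ⟨
    S * L                   ≈⟨ *-congʳ S≈0 ⟩
    0# * L                  ≈⟨ zeroˡ L ⟩
    0#                      ∎)
    where
    rest : Fin v → Carrier
    rest g = if g ≠ᵇ e then χ g * L else 0#
    χe*L≈L : χ e * L ≈ L
    χe*L≈L = trans (*-congʳ unit) (*-identityˡ L)
    off-e : ∀ g → (if g ≠ᵇ e then χ g * c g else 0#) ≈ rest g
    off-e g with g ≠ᵇ e in g≠e
    ... | true  = *-congˡ (c≈L g (≠ᵇ⇒≢ g≠e))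
    ... | false = refl
    weighted≈rest : ∑ (λ g → χ g * c g) ≈ ∑ rest
    weighted≈rest = trans (∑-split (λ g → χ g * c g) e)
      (trans (+-cong (trans (*-congˡ ce≈0) (zeroʳ (χ e))) (∑-cong off-e)) (+-identityˡ (∑ rest)))

module SEDF {c ℓ} (K : FieldWithConj c ℓ) {v : ℕ} (G : FinAbGroup v)
            (χ : Fin v → FieldWithConj.Carrier K) (isχ : IsCharacter K G χ)
            {m k lam : ℕ} (D : Fin m → Subset v) (sedf : IsSEDF G m k lam D) where
  open FieldWithConj K
  open FieldFacts K
  open GroupFacts G
  open Characters K G χ isχ
  open FinAbGroup G using (e)
  open IsSEDF sedf
  open CommutativeRing commRing using (+-congˡ; reflexive)
  open import Relation.Binary.Reasoning.Setoid setoid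

  A B : Fin m → Carrier
  A l = χ[ lookup (D l) ]
  B j = χ[ inOthers D j ]
  T : Carrier
  T = ∑ A

  block-unique : ∀ g l l' → lookup (D l) g ≡ true → lookup (D l') g ≡ true → l ≡ l'
  block-unique g l l' g∈Dl g∈Dl' with l ≟ l'
  ... | yes l≡l' = l≡l'
  ... | no  l≢l' =
    ⊥-elim (disjoint l l' l≢l' (g , x∈p∩q⁺ (lookup⇒[]= g (D l) g∈Dl , lookup⇒[]= g (D l') g∈Dl')))

  others-disjoint : ∀ j y → lookup (D j) y ≡ true → inOthers D j y ≡ true → ⊥
  others-disjoint j y y∈Dj y∈others with anyFin-witness (λ i → (i ≠ᵇ j) ∧ lookup (D i) y) y∈others
  ... | i , i≠j∧y∈Di with i ≠ᵇ j in i≠j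
  ... | true = ≠ᵇ⇒≢ i≠j (block-unique y i j i≠j∧y∈Di y∈Dj)

  B≈∑others : ∀ j → B j ≈ ∑ (λ l → if l ≠ᵇ j then A l else 0#)
  B≈∑others j = begin
    B j
      ≈⟨ ∑-cong (λ g → ∑-anyFin (Q g) (Q-unique g) (χ g)) ⟨
    ∑ (λ g → ∑ (λ l → if Q g l then χ g else 0#))
      ≈⟨ ∑-comm (λ g l → if Q g l then χ g else 0#) ⟩
    ∑ (λ l → ∑ (λ g → if (l ≠ᵇ j) ∧ lookup (D l) g then χ g else 0#))
      ≈⟨ ∑-cong (λ l → guard (l ≠ᵇ j) (lookup (D l))) ⟩
    ∑ (λ l → if l ≠ᵇ j then A l else 0#)
      ∎
    where
    Q : Fin v → Fin m → Bool
    Q g l = (l ≠ᵇ j) ∧ lookup (D l) g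
    Q-unique : ∀ g l l' → Q g l ≡ true → Q g l' ≡ true → l ≡ l'
    Q-unique g l l' Ql Ql' = block-unique g l l' (∧-true-right Ql) (∧-true-right Ql')
      where
      ∧-true-right : ∀ {a b} → (a ∧ b) ≡ true → b ≡ true
      ∧-true-right {true} b≡true = b≡true
    guard : ∀ b P → ∑ (λ g → if b ∧ P g then χ g else 0#) ≈ (if b then χ[ P ] else 0#)
    guard true  P = refl
    guard false P = ∑-zero {v} (λ _ → refl)

  partition : ∀ j → A j + B j ≈ T
  partition j = trans (+-congˡ (B≈∑others j)) (sym (∑-split A j))

  SEDF-equation : S ≈ 0# → ∀ j → A j * conj (B j) ≈ - fromℕ lam
  SEDF-equation S≈0 j = begin
    A j * conj (B j)                 ≈⟨ χ-product (lookup (D j)) (inOthers D j) ⟨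
    χ[ lookup (D j) / inOthers D j ] ≈⟨ χ-difference (lookup (D j)) (inOthers D j) ⟩
    ∑ (λ g → χ g * count-j g)        ≈⟨ ∑-χ-off-identity S≈0 count-j count-j-e count-j-≠e ⟩
    - fromℕ lam                      ∎
    where
    count-j : Fin v → Carrier
    count-j g = fromℕ (diffCount (lookup (D j)) (inOthers D j) g)
    count-j-e : count-j e ≈ 0#
    count-j-e = reflexive (≡.cong fromℕ (diffCount-e (lookup (D j)) (inOthers D j) (others-disjoint j)))
    count-j-≠e : ∀ g → ¬ g ≡ e → count-j g ≈ fromℕ lam
    count-j-≠e g g≢e = reflexive (≡.cong fromℕ (count j g g≢e))

lemma6 : ∀ {c ℓ} (K : FieldWithConj c ℓ) {v : ℕ} (G : FinAbGroup v)
         (m k lam : ℕ) (D : Fin m → Subset v) →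
         IsSEDF G m k lam D → 3 ≤ m →
         (χ : Fin v → FieldWithConj.Carrier K) →
         IsCharacter K G χ → ¬ IsPrincipal K G χ →
         ¬ FieldWithConj._≈_ K (χᴰ K G χ D) (FieldWithConj.0# K) →
         (i j : Fin m) →
         ¬ FieldWithConj._≈_ K (χˢ K G χ (D i)) (χˢ K G χ (D j)) →
         let open FieldWithConj K in
         ((χᴰ K G χ D - χˢ K G χ (D i) - χˢ K G χ (D j)) ≈ 0#)
         × (∑ (λ l → if (l ≠ᵇ i) ∧ (l ≠ᵇ j) then χˢ K G χ (D l) else 0#) ≈ 0#)
         × (χ-AB⁻ K G χ (D i) (D j) ≈ - fromℕ lam)
         × ((χˢ K G χ (D i) * conj (χˢ K G χ (D j))) ≈ - fromℕ lam)
lemma6 K G m k lam D sedf _ χ isχ _ T≉0 i j Aᵢ≉Aⱼ =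
  T-Aᵢ-Aⱼ≈0 , others≈0 , trans (χ-product (lookup (D i)) (lookup (D j))) AᵢAⱼ≈-λ , AᵢAⱼ≈-λ
  where
  open FieldWithConj K
  open FieldFacts K
  open Characters K G χ isχ
  open SEDF K G χ isχ D sedf
  open CommutativeRing commRing using (+-comm; *-congˡ; +-group)
  open import Algebra.Properties.Group +-group using (x≈z//y; x≈y⇒x∙y⁻¹≈ε; ∙-cancelˡ)
  open IsSEDF sedf using (size)
  -- χ(G) = 0 because Dᵢ, Dⱼ have the same size but different χ-values.
  S≈0 : S ≈ 0#
  S≈0 = χ-sum-vanishes (D i) (D j) (≡.trans (size i) (≡.sym (size j))) Aᵢ≉Aⱼ
  Aᵢ+Aⱼ≈T : A i + A j ≈ T
  Aᵢ+Aⱼ≈T = complementary-pair (conj-fromℕ lam) T≉0 Aᵢ≉Aⱼ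
    (partition i) (SEDF-equation S≈0 i) (partition j) (SEDF-equation S≈0 j)
  Bᵢ≈Aⱼ : B i ≈ A j
  Bᵢ≈Aⱼ = ∙-cancelˡ (A i) (B i) (A j) (trans (partition i) (sym Aᵢ+Aⱼ≈T))
  T-Aᵢ-Aⱼ≈0 : T - A i - A j ≈ 0#
  T-Aᵢ-Aⱼ≈0 = x≈y⇒x∙y⁻¹≈ε (sym (x≈z//y (A j) (A i) T (trans (+-comm (A j) (A i)) Aᵢ+Aⱼ≈T)))
  j≢i : ¬ j ≡ i
  j≢i ≡.refl = Aᵢ≉Aⱼ refl
  others≈0 : ∑ (λ l → if (l ≠ᵇ i) ∧ (l ≠ᵇ j) then A l else 0#) ≈ 0#
  others≈0 = ∑-others-vanish A i j j≢i Aᵢ+Aⱼ≈T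
  AᵢAⱼ≈-λ : A i * conj (A j) ≈ - fromℕ lam
  AᵢAⱼ≈-λ = trans (*-congˡ (conj-cong (sym Bᵢ≈Aⱼ))) (SEDF-equation S≈0 i)
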